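{- Suppose ${\mathcal V}$ is a minimally informative useful d-view for $Q$ within $\mathcal C$, and there is a d-view based on views in $\mathcal C$ that is useful for $Q$ and non-disclosing for $Q_{\mathrm{sec}}$ according to non-disclosure function $F$. Then ${\mathcal V}$ is useful for $Q$ and non-disclosing for $Q_{\mathrm{sec}}$ according to $F$.
   Context: A distributed schema (d-schema) consists of finitely many sources, each with its own local schema (pairwise disjoint relations). A d-view assigns to each source a finite set of views (queries) over that source's local schema only. Two d-instances are ${\mathcal V}$-indistinguishable if every view of ${\mathcal V}$ returns the same output on both. ${\mathcal V}$ determines a query $Q$ at a d-instance $D$ if $Q(D')=Q(D)$ for every $D'$ that is ${\mathcal V}$-indistinguishable from $D$. ${\mathcal V}$ is useful for $Q$ if it determines $Q$ on every d-instance. Given a class of views $\mathcal C$, ${\mathcal V}$ is a minimally informative useful d-view for $Q$ within $\mathcal C$ if ${\mathcal V}$ is useful for $Q$ and every other d-view built from views in $\mathcal C$ that is useful for $Q$ determines each view definition of ${\mathcal V}$. A non-disclosure function $F$ specifies, for each query $Q_{\mathrm{sec}}$ (the secret query), the set of d-views said to disclose $Q_{\mathrm{sec}}$; it is required to be determinacy-compatible: if ${\mathcal V}_2$ discloses $Q_{\mathrm{sec}}$ according to $F$ and ${\mathcal V}_1$ determines each view in ${\mathcal V}_2$, then ${\mathcal V}_1$ also discloses $Q_{\mathrm{sec}}$. A d-view that does not disclose $Q_{\mathrm{sec}}$ is called non-disclosing for $Q_{\mathrm{sec}}$. -}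

module Defs where

open import Data.Nat using (ℕ)
open import Data.Fin using (Fin)
open import Data.List using (List)
open import Data.List.Relation.Unary.All using (All)
open import Data.List.Membership.Propositional using (_∈_)
open import Relation.Binary.PropositionalEquality using (_≡_)
open import Relation.Nullary using (¬_)

-- Inst i is the set of instances of
-- the local schema of source i (local schemas are pairwise disjoint, so a
-- d-instance is just a choice of a local instance for every source).
-- Out is the (common) type of query/view outputs (e.g. finite relations).
module DSchema (n : ℕ) (Inst : Fin n → Set) (Out : Set) where

  DInst : Set
  DInst = (i : Fin n) → Inst i

  Query : Set
  Query = DInst → Out

  LocalView : Fin n → Set
  LocalView i = Inst i → Out

  DView : Set
  DView = (i : Fin n) → List (LocalView i)

  asQuery : {i : Fin n} → LocalView i → Query
  asQuery {i} v D = v (D i)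

  Indist : DView → DInst → DInst → Set
  Indist V D D' = (i : Fin n) → All (λ v → v (D i) ≡ v (D' i)) (V i)

  DeterminesAt : DView → Query → DInst → Set
  DeterminesAt V Q D = (D' : DInst) → Indist V D D' → Q D' ≡ Q D

  Useful : DView → Query → Set
  Useful V Q = (D : DInst) → DeterminesAt V Q D

  DeterminesViews : DView → DView → Set
  DeterminesViews V1 V2 = (i : Fin n) → (v : LocalView i) → v ∈ V2 i → Useful V1 (asQuery v)

  ViewClass : Set₁
  ViewClass = (i : Fin n) → LocalView i → Set

  BasedOn : ViewClass → DView → Set
  BasedOn C V = (i : Fin n) → All (C i) (V i)

  MinInfUseful : ViewClass → Query → DView → Set
  MinInfUseful C Q V =
    Useful V Q × ((V' : DView) → BasedOn C V' → Useful V' Q → DeterminesViews V' V)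
    where open import Data.Product using (_×_)

  -- non-disclosure function: F Qsec V means "V discloses Qsec"
  NonDisclosureFunction : Set₁
  NonDisclosureFunction = Query → DView → Set

  DeterminacyCompatible : NonDisclosureFunction → Set
  DeterminacyCompatible F =
    (Qsec : Query) (V₁ V₂ : DView) → F Qsec V₂ → DeterminesViews V₁ V₂ → F Qsec V₁

  NonDisclosing : NonDisclosureFunction → Query → DView → Set
  NonDisclosing F Qsec V = ¬ F Qsec V

module Submission where

-- Determinacy-compatibility of a non-disclosure function F says
-- that disclosure propagates upward along determinacy: if V₁ determines every
-- view of V₂ and V₂ discloses Qsec, so does V₁.  Read contrapositively,
-- non-disclosure propagates downward: anything determined by a non-disclosing
-- d-view is itself non-disclosing.
--
-- A minimally informative useful d-view V for Q within C is, by definition,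
-- determined by every d-view based on C that is useful for Q; in particular
-- by the given useful, non-disclosing witness W.  Hence V is non-disclosing,
-- and it is useful for Q as part of being minimally informative useful.

open import Defs
open import Data.Nat using (ℕ)
open import Data.Fin using (Fin)
open import Data.Product using (_×_; Σ; _,_)

module _ {n : ℕ} {Inst : Fin n → Set} {Out : Set} where
  open DSchema n Inst Out

  nonDisclosing-determined : (F : NonDisclosureFunction) → DeterminacyCompatible F →
    (Qsec : Query) (W V : DView) →
    DeterminesViews W V → NonDisclosing F Qsec W → NonDisclosing F Qsec V
  nonDisclosing-determined F compatible Qsec W V W⇒V W-safe V-discloses =
    W-safe (compatible Qsec W V V-discloses W⇒V)

mainTheorem3 : (n : ℕ) (Inst : Fin n → Set) (Out : Set) →
    let open DSchema n Inst Out in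
    (C : ViewClass) (Q Qsec : Query) (F : NonDisclosureFunction) →
    DeterminacyCompatible F →
    (V : DView) → MinInfUseful C Q V →
    Σ DView (λ W → BasedOn C W × Useful W Q × NonDisclosing F Qsec W) →
    Useful V Q × NonDisclosing F Qsec V
mainTheorem3 n Inst Out C Q Qsec F compatible V (V-useful , V-minimal)
             (W , W-based , W-useful , W-safe) =
  V-useful , nonDisclosing-determined F compatible Qsec W V W⇒V W-safe
  where
  open DSchema n Inst Out
  W⇒V : DeterminesViews W V
  W⇒V = V-minimal W W-based W-useful
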